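{- Let $\gamma\ge 1$ be an ordinal and $f$ a unary monotone function in $\mathfrak{F}_\gamma$ with $f(x)\ge\max(1,x)$ for all $x$. Then for all $k\ge 1$, $G_k$ belongs to $\mathfrak{F}_{\gamma+k-1}$.
   Context: $N_k(x)=k\cdot(f(x)-1)$; $G_1(x)=f(x)+x$ and $G_{k+1}(x)=G_k^{N_{k+1}(x)}(x+1)$, where $g^p$ is $p$-fold iteration. Fast Growing Hierarchy: $F_0(x)=x+1$, $F_{\alpha+1}(x)=F_\alpha^{x+1}(x)$ (standard Löb–Wainer hierarchy for ordinals); $\mathfrak{F}_\alpha$ is the closure of the constant zero function, addition, projections and the $F_\beta$ for $\beta\le\alpha$ under substitution and limited primitive recursion. -}

module Defs where

open import Data.Nat using (ℕ; zero; suc; _+_; _*_; _∸_; _≤_)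
open import Data.Fin using (Fin; zero; suc)
open import Data.Vec using (Vec; []; _∷_; lookup; head; tabulate)
open import Data.Sum using (_⊎_)
open import Relation.Binary.PropositionalEquality using (_≡_)

-- Ordinals below ε₀ in Cantor normal form:  ω^ a + b

data Ord : Set where
  𝟎     : Ord
  ω^_+_ : Ord → Ord → Ord

infix 4 _<ₒ_ _≤ₒ_

data _<ₒ_ : Ord → Ord → Set where
  0<ω   : ∀ {a b} → 𝟎 <ₒ ω^ a + b
  exp<  : ∀ {a b c d} → a <ₒ c → ω^ a + b <ₒ ω^ c + d
  tail< : ∀ {a b d} → b <ₒ d → ω^ a + b <ₒ ω^ a + d

_≤ₒ_ : Ord → Ord → Set
a ≤ₒ b = (a <ₒ b) ⊎ (a ≡ b)

data HeadLE : Ord → Ord → Set where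
  h0 : ∀ {a} → HeadLE 𝟎 a
  hω : ∀ {c d a} → c ≤ₒ a → HeadLE (ω^ c + d) a

data IsCNF : Ord → Set where
  cnf0 : IsCNF 𝟎
  cnfω : ∀ {a b} → IsCNF a → IsCNF b → HeadLE b a → IsCNF (ω^ a + b)

sucₒ : Ord → Ord
sucₒ 𝟎 = ω^ 𝟎 + 𝟎
sucₒ (ω^ a + b) = ω^ a + sucₒ b

1ₒ : Ord
1ₒ = sucₒ 𝟎

_+ₒ_ : Ord → ℕ → Ord
α +ₒ zero = α
α +ₒ suc n = sucₒ (α +ₒ n)

-- Standard fundamental sequences, via Brouwer trees:
--   (ω^a + b)[x] = ω^a + b[x]   (b ≠ 0),
--   ω^(β+1)[x] = ω^β · x,   ω^λ[x] = ω^(λ[x]).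

data Tree : Set where
  zT : Tree
  sT : Tree → Tree
  lT : (ℕ → Tree) → Tree

_⊕_ : Tree → Tree → Tree
a ⊕ zT = a
a ⊕ sT b = sT (a ⊕ b)
a ⊕ lT f = lT (λ n → a ⊕ f n)

_⊗ℕ_ : Tree → ℕ → Tree
a ⊗ℕ zero = zT
a ⊗ℕ suc zero = a
a ⊗ℕ suc (suc n) = (a ⊗ℕ suc n) ⊕ a

ωT^ : Tree → Tree
ωT^ zT = sT zT
ωT^ (sT a) = lT (λ n → ωT^ a ⊗ℕ n)
ωT^ (lT f) = lT (λ n → ωT^ (f n))

⟦_⟧ : Ord → Tree
⟦ 𝟎 ⟧ = zT
⟦ ω^ a + b ⟧ = ωT^ ⟦ a ⟧ ⊕ ⟦ b ⟧

iter : ℕ → (ℕ → ℕ) → ℕ → ℕ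
iter zero g x = x
iter (suc p) g x = g (iter p g x)

FT : Tree → ℕ → ℕ
FT zT x = suc x
FT (sT a) x = iter (suc x) (FT a) x
FT (lT f) x = FT (f x) x

F : Ord → ℕ → ℕ
F α = FT ⟦ α ⟧

data 𝔉 (α : Ord) : (n : ℕ) → (Vec ℕ n → ℕ) → Set where
  zeroᶠ  : ∀ {n} → 𝔉 α n (λ _ → 0)
  addᶠ   : 𝔉 α 2 (λ v → lookup v zero + lookup v (suc zero))
  projᶠ  : ∀ {n} (i : Fin n) → 𝔉 α n (λ v → lookup v i)
  Fᶠ     : ∀ β → IsCNF β → β ≤ₒ α → 𝔉 α 1 (λ v → F β (head v))
  substᶠ : ∀ {m n} {h : Vec ℕ m → ℕ} {gs : Fin m → Vec ℕ n → ℕ} →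
           𝔉 α m h → (∀ i → 𝔉 α n (gs i)) →
           𝔉 α n (λ v → h (tabulate (λ i → gs i v)))
  lrecᶠ  : ∀ {n} {g : Vec ℕ n → ℕ} {h : Vec ℕ (suc (suc n)) → ℕ}
             {b : Vec ℕ (suc n) → ℕ} (r : Vec ℕ (suc n) → ℕ) →
           𝔉 α n g → 𝔉 α (suc (suc n)) h → 𝔉 α (suc n) b →
           (∀ v → r (0 ∷ v) ≡ g v) →
           (∀ y v → r (suc y ∷ v) ≡ h (y ∷ r (y ∷ v) ∷ v)) →
           (∀ v → r v ≤ b v) →
           𝔉 α (suc n) r
  -- classes are sets of functions (extensional)
  extᶠ   : ∀ {n} {h h' : Vec ℕ n → ℕ} → 𝔉 α n h → (∀ v → h v ≡ h' v) → 𝔉 α n h'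

-- N_k and G_k  (G f 0 is unused; only k ≥ 1 matters)

N : (ℕ → ℕ) → ℕ → ℕ → ℕ
N f k x = k * (f x ∸ 1)

G : (ℕ → ℕ) → ℕ → ℕ → ℕ
G f zero x = 0
G f (suc zero) x = f x + x
G f (suc (suc k)) x = iter (N f (suc (suc k)) x) (G f (suc k)) (suc x)

module Submission where

-- G_k ∈ 𝔉_{γ+k-1}, by induction on k.  G_1 = f + id lies in 𝔉_γ by closure
-- under addition; since G_{k+1}(x) = G_k^{N_{k+1}(x)}(x+1), the step follows by
-- substitution from the closure property
--
--   (★)  if g ∈ 𝔉_δ (δ ≥ 1) then (y, x) ↦ g^y(x) belongs to 𝔉_{δ+1}.
--
-- The content of (★) is a bound in 𝔉_{δ+1} making the recursion defining g^y
-- limited.  By the majorization lemma every member of 𝔉_δ is bounded by an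
-- iterate F_δ^m of F_δ on the maximum of its arguments, whence
-- g^y(x) ≤ F_δ^{m·y}(x) ≤ F_{δ+1}(m·y + x).  Majorization needs F_β ≤ F_δ^m for
-- β ≤ δ: for β < δ in Cantor normal form, the tree of β+1 is reached from that
-- of δ by descending along x-th members of fundamental sequences for all large
-- x, and F_t does not increase under such descents when t is well formed.

open import Defs
open import Data.Nat using (ℕ; zero; suc; _+_; _*_; _∸_; _≤_; _⊔_; _≤′_; ≤′-step; ≤′-refl; z≤n; s≤s)
open import Data.Nat.Properties
open import Data.Vec using (Vec; []; _∷_; head; lookup; tabulate)
open import Data.Fin using (Fin; zero; suc)
open import Data.Product using (_×_; Σ-syntax; _,_)
open import Data.Sum using (inj₁; inj₂)
open import Relation.Binary.Core using (_Preserves_⟶_)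
open import Relation.Binary.PropositionalEquality
open ≤-Reasoning

Inflationary : (ℕ → ℕ) → Set
Inflationary g = ∀ z → z ≤ g z

Monotone : (ℕ → ℕ) → Set
Monotone g = g Preserves _≤_ ⟶ _≤_

iter-+ : ∀ (g : ℕ → ℕ) m n z → iter (m + n) g z ≡ iter m g (iter n g z)
iter-+ g zero n z = refl
iter-+ g (suc m) n z = cong g (iter-+ g m n z)

iter-* : ∀ (g : ℕ → ℕ) y m z → iter y (iter m g) z ≡ iter (y * m) g z
iter-* g zero m z = refl
iter-* g (suc y) m z = trans (cong (iter m g) (iter-* g y m z)) (sym (iter-+ g m (y * m) z))

iter-suc : ∀ n z → iter n suc z ≡ n + z
iter-suc zero z = refl
iter-suc (suc n) z = cong suc (iter-suc n z)

iter-cong : ∀ {g h : ℕ → ℕ} → (∀ z → g z ≡ h z) → ∀ n z → iter n g z ≡ iter n h z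
iter-cong e zero z = refl
iter-cong {g} e (suc n) z = trans (cong g (iter-cong e n z)) (e _)

iter-inflationary : ∀ {g} → Inflationary g → ∀ n → Inflationary (iter n g)
iter-inflationary infl zero z = ≤-refl
iter-inflationary infl (suc n) z = ≤-trans (iter-inflationary infl n z) (infl _)

iter-mono-count : ∀ {g} → Inflationary g → ∀ {n n'} z → n ≤ n' → iter n g z ≤ iter n' g z
iter-mono-count {g} infl z p = go (≤⇒≤′ p)
  where
  go : ∀ {n n'} → n ≤′ n' → iter n g z ≤ iter n' g z
  go ≤′-refl = ≤-refl
  go (≤′-step q) = ≤-trans (go q) (infl _)

iter-mono : ∀ {g} → Monotone g → ∀ n → Monotone (iter n g)
iter-mono mono zero p = p
iter-mono mono (suc n) p = mono (iter-mono mono n p)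

iter-dominated : ∀ {g h} → (∀ z → g z ≤ h z) → Monotone h → ∀ n z → iter n g z ≤ iter n h z
iter-dominated g≤h mono zero z = ≤-refl
iter-dominated g≤h mono (suc n) z = ≤-trans (g≤h _) (mono (iter-dominated g≤h mono n z))

iter-expansive : ∀ {g} → (∀ z → suc z ≤ g z) → ∀ n z → n + z ≤ iter n g z
iter-expansive exp zero z = ≤-refl
iter-expansive exp (suc n) z = ≤-trans (s≤s (iter-expansive exp n z)) (exp _)

-- Limits are compared pointwise; ⊕ is associative only up to this relation.
infix 4 _≈_
data _≈_ : Tree → Tree → Set where
  z≈ : zT ≈ zT
  s≈ : ∀ {a b} → a ≈ b → sT a ≈ sT b
  l≈ : ∀ {f g} → (∀ n → f n ≈ g n) → lT f ≈ lT g

≈-refl : ∀ t → t ≈ t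
≈-refl zT = z≈
≈-refl (sT t) = s≈ (≈-refl t)
≈-refl (lT f) = l≈ (λ n → ≈-refl (f n))

≈-trans : ∀ {a b c} → a ≈ b → b ≈ c → a ≈ c
≈-trans z≈ z≈ = z≈
≈-trans (s≈ p) (s≈ q) = s≈ (≈-trans p q)
≈-trans (l≈ p) (l≈ q) = l≈ (λ n → ≈-trans (p n) (q n))

⊕-cong : ∀ {a a' b b'} → a ≈ a' → b ≈ b' → a ⊕ b ≈ a' ⊕ b'
⊕-cong ea z≈ = ea
⊕-cong ea (s≈ e) = s≈ (⊕-cong ea e)
⊕-cong ea (l≈ es) = l≈ (λ n → ⊕-cong ea (es n))

⊗ℕ-cong : ∀ {a a'} → a ≈ a' → ∀ n → a ⊗ℕ n ≈ a' ⊗ℕ n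
⊗ℕ-cong e zero = z≈
⊗ℕ-cong e (suc zero) = e
⊗ℕ-cong e (suc (suc n)) = ⊕-cong (⊗ℕ-cong e (suc n)) e

ωT^-cong : ∀ {a b} → a ≈ b → ωT^ a ≈ ωT^ b
ωT^-cong z≈ = s≈ z≈
ωT^-cong (s≈ e) = l≈ (⊗ℕ-cong (ωT^-cong e))
ωT^-cong (l≈ es) = l≈ (λ n → ωT^-cong (es n))

⊕-assoc : ∀ a b c → a ⊕ (b ⊕ c) ≈ (a ⊕ b) ⊕ c
⊕-assoc a b zT = ≈-refl _
⊕-assoc a b (sT c) = s≈ (⊕-assoc a b c)
⊕-assoc a b (lT g) = l≈ (λ n → ⊕-assoc a b (g n))

⊗ℕ-suc : ∀ a k → a ⊕ (a ⊗ℕ k) ≈ a ⊗ℕ suc k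
⊗ℕ-suc a zero = ≈-refl a
⊗ℕ-suc a (suc zero) = ≈-refl _
⊗ℕ-suc a (suc (suc k)) = ≈-trans (⊕-assoc a (a ⊗ℕ suc k) a) (⊕-cong (⊗ℕ-suc a (suc k)) (≈-refl a))

FT-cong : ∀ {a b} → a ≈ b → ∀ y → FT a y ≡ FT b y
FT-cong z≈ y = refl
FT-cong (s≈ e) y = iter-cong (FT-cong e) (suc y) y
FT-cong (l≈ es) y = FT-cong (es y) y

-- Descent along fundamental sequences

infix 4 _≼[_]_
data _≼[_]_ (a : Tree) (x : ℕ) : Tree → Set where
  here  : ∀ {b} → a ≈ b → a ≼[ x ] b
  sstep : ∀ {c} → a ≼[ x ] c → a ≼[ x ] sT c
  lstep : ∀ {g} → a ≼[ x ] g x → a ≼[ x ] lT g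

≼-≈ : ∀ {a b c x} → a ≼[ x ] b → b ≈ c → a ≼[ x ] c
≼-≈ (here e) e' = here (≈-trans e e')
≼-≈ (sstep d) (s≈ e) = sstep (≼-≈ d e)
≼-≈ {x = x} (lstep d) (l≈ es) = lstep (≼-≈ d (es x))

≼-trans : ∀ {a b c x} → a ≼[ x ] b → b ≼[ x ] c → a ≼[ x ] c
≼-trans d (here e) = ≼-≈ d e
≼-trans d (sstep d') = sstep (≼-trans d d')
≼-trans d (lstep d') = lstep (≼-trans d d')

⊕-monoʳ-≼ : ∀ {a b x} c → a ≼[ x ] b → c ⊕ a ≼[ x ] c ⊕ b
⊕-monoʳ-≼ c (here e) = here (⊕-cong (≈-refl c) e)
⊕-monoʳ-≼ c (sstep d) = sstep (⊕-monoʳ-≼ c d)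
⊕-monoʳ-≼ c (lstep d) = lstep (⊕-monoʳ-≼ c d)

≼-⊕ : ∀ a b x → a ≼[ x ] a ⊕ b
≼-⊕ a zT x = here (≈-refl a)
≼-⊕ a (sT b) x = sstep (≼-⊕ a b x)
≼-⊕ a (lT g) x = lstep (≼-⊕ a (g x) x)

zT-≼ : ∀ t x → zT ≼[ x ] t
zT-≼ zT x = here z≈
zT-≼ (sT t) x = sstep (zT-≼ t x)
zT-≼ (lT g) x = lstep (zT-≼ (g x) x)

⊗ℕ-step-≼ : ∀ a n x → a ⊗ℕ n ≼[ x ] a ⊗ℕ suc n
⊗ℕ-step-≼ a zero x = zT-≼ _ x
⊗ℕ-step-≼ a (suc n) x = ≼-⊕ (a ⊗ℕ suc n) a x

⊗ℕ-mono-≼ : ∀ a {n n'} x → n ≤ n' → a ⊗ℕ n ≼[ x ] a ⊗ℕ n'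
⊗ℕ-mono-≼ a {n} x p = go (≤⇒≤′ p)
  where
  go : ∀ {n'} → n ≤′ n' → a ⊗ℕ n ≼[ x ] a ⊗ℕ n'
  go ≤′-refl = here (≈-refl _)
  go (≤′-step {m} q) = ≼-trans (go q) (⊗ℕ-step-≼ a m x)

-- for x ≥ 1, exponentiation preserves descent (ω^c ≼ ω^c·x is a member of ω^(c+1)[x])
ωT^-mono-≼ : ∀ {a b x} → 1 ≤ x → a ≼[ x ] b → ωT^ a ≼[ x ] ωT^ b
ωT^-mono-≼ p (here e) = here (ωT^-cong e)
ωT^-mono-≼ {x = x} p (sstep {c} d) =
  ≼-trans (ωT^-mono-≼ p d) (lstep {g = ωT^ c ⊗ℕ_} (⊗ℕ-mono-≼ (ωT^ c) x p))
ωT^-mono-≼ p (lstep d) = lstep (ωT^-mono-≼ p d)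

one-≼-ωT^ : ∀ a x → 1 ≤ x → sT zT ≼[ x ] ωT^ a
one-≼-ωT^ zT x p = here (s≈ z≈)
one-≼-ωT^ (sT a) x p = lstep (≼-trans (one-≼-ωT^ a x p) (⊗ℕ-mono-≼ (ωT^ a) x p))
one-≼-ωT^ (lT f) x p = lstep (one-≼-ωT^ (f x) x p)

-- Fundamental sequences increase w.r.t. descent (the Bachmann property).
data WF : Tree → Set where
  wz : WF zT
  ws : ∀ {a} → WF a → WF (sT a)
  wl : ∀ {g} → (∀ n → WF (g n)) → (∀ n → g n ≼[ suc n ] g (suc n)) → WF (lT g)

WF-⊕ : ∀ {a b} → WF a → WF b → WF (a ⊕ b)
WF-⊕ wa wz = wa
WF-⊕ wa (ws wb) = ws (WF-⊕ wa wb)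
WF-⊕ {a} wa (wl wfs ch) = wl (λ n → WF-⊕ wa (wfs n)) (λ n → ⊕-monoʳ-≼ a (ch n))

WF-⊗ℕ : ∀ {a} → WF a → ∀ n → WF (a ⊗ℕ n)
WF-⊗ℕ wa zero = wz
WF-⊗ℕ wa (suc zero) = wa
WF-⊗ℕ wa (suc (suc n)) = WF-⊕ (WF-⊗ℕ wa (suc n)) wa

WF-ωT^ : ∀ {a} → WF a → WF (ωT^ a)
WF-ωT^ wz = ws wz
WF-ωT^ (ws {a} wa) = wl (WF-⊗ℕ (WF-ωT^ wa)) (λ n → ⊗ℕ-step-≼ (ωT^ a) n (suc n))
WF-ωT^ (wl wfs ch) = wl (λ n → WF-ωT^ (wfs n)) (λ n → ωT^-mono-≼ (s≤s z≤n) (ch n))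

WF-⟦⟧ : ∀ α → WF ⟦ α ⟧
WF-⟦⟧ 𝟎 = wz
WF-⟦⟧ (ω^ a + b) = WF-⊕ (WF-ωT^ (WF-⟦⟧ a)) (WF-⟦⟧ b)

mutual
  FT-expansive : ∀ t x → suc x ≤ FT t x
  FT-expansive zT x = ≤-refl
  FT-expansive (sT a) x =
    ≤-trans (s≤s (iter-inflationary (FT-inflationary a) x x)) (FT-expansive a (iter x (FT a) x))
  FT-expansive (lT g) x = FT-expansive (g x) x

  FT-inflationary : ∀ t → Inflationary (FT t)
  FT-inflationary t z = ≤-trans (n≤1+n z) (FT-expansive t z)

mutual
  FT-mono : ∀ {t} → WF t → Monotone (FT t)
  FT-mono wz p = s≤s p
  FT-mono (ws {a} wa) {x} {y} p =
    ≤-trans (iter-mono-count (FT-inflationary a) x (s≤s p)) (iter-mono (FT-mono wa) (suc y) p)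
  FT-mono (wl wfs ch) {x} p = ≤-trans (FT-mono (wfs x) p) (FT-limit (wl wfs ch) p)

  FT-limit : ∀ {g} → WF (lT g) → ∀ {x y} → x ≤ y → FT (g x) y ≤ FT (lT g) y
  FT-limit w p = FT-sequence w (≤⇒≤′ p) ≤-refl

  FT-sequence : ∀ {g} → WF (lT g) → ∀ {x z y} → x ≤′ z → z ≤ y → FT (g x) y ≤ FT (g z) y
  FT-sequence w ≤′-refl q = ≤-refl
  FT-sequence (wl wfs ch) (≤′-step {z} p) q =
    ≤-trans (FT-sequence (wl wfs ch) p (≤-trans (n≤1+n z) q)) (FT-descent (wfs (suc z)) (ch z) q)

  FT-descent : ∀ {a b x} → WF b → a ≼[ x ] b → ∀ {y} → x ≤ y → FT a y ≤ FT b y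
  FT-descent _ (here e) p = ≤-reflexive (FT-cong e _)
  FT-descent (ws {c} wc) (sstep d) {y} p =
    ≤-trans (FT-descent wc d p) (FT-mono wc (iter-inflationary (FT-inflationary c) y y))
  FT-descent (wl wfs ch) (lstep d) p = ≤-trans (FT-descent (wfs _) d p) (FT-limit (wl wfs ch) p)

F-mono : ∀ α → Monotone (F α)
F-mono α = FT-mono (WF-⟦⟧ α)

Eventually : (ℕ → Set) → Set
Eventually P = Σ[ N ∈ ℕ ] (∀ x → N ≤ x → P x)

eventually-map : ∀ {P Q : ℕ → Set} → (∀ {x} → P x → Q x) → Eventually P → Eventually Q
eventually-map f (N , p) = N , λ x q → f (p x q)

eventually-map₂ : ∀ {P Q R : ℕ → Set} → (∀ {x} → P x → Q x → R x) →
                  Eventually P → Eventually Q → Eventually R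
eventually-map₂ f (M , p) (N , q) =
  M ⊔ N , λ x r → f (p x (≤-trans (m≤m⊔n M N) r)) (q x (≤-trans (m≤n⊔m M N) r))

infix 4 _⊑_
_⊑_ : Tree → Tree → Set
a ⊑ b = Eventually (λ x → a ≼[ x ] b)

⊑-trans : ∀ {a b c} → a ⊑ b → b ⊑ c → a ⊑ c
⊑-trans = eventually-map₂ ≼-trans

ωT^-mono-⊑ : ∀ {a b} → a ⊑ b → ωT^ a ⊑ ωT^ b
ωT^-mono-⊑ = eventually-map₂ ωT^-mono-≼ (1 , λ x p → p)

-- ω^a·K ⊑ ω^(a+1): for x ≥ K, ω^a·K ≼ ω^a·x = ω^(a+1)[x]
multiple-⊑-ωT^suc : ∀ a K → ωT^ a ⊗ℕ K ⊑ ωT^ (sT a)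
multiple-⊑-ωT^suc a K = K , λ x p → lstep {g = ωT^ a ⊗ℕ_} (⊗ℕ-mono-≼ (ωT^ a) x p)

absorb-term : ∀ a {b} K → sT b ⊑ ωT^ a ⊗ℕ K → sT (ωT^ a ⊕ b) ⊑ ωT^ a ⊗ℕ suc K
absorb-term a K = eventually-map (λ d → ≼-≈ (⊕-monoʳ-≼ (ωT^ a) d) (⊗ℕ-suc (ωT^ a) K))

mutual
  succ-⊑ : ∀ {β γ} → IsCNF β → β <ₒ γ → sT ⟦ β ⟧ ⊑ ⟦ γ ⟧
  succ-⊑ _ (0<ω {a} {b}) = 1 , λ x p → ≼-trans (one-≼-ωT^ ⟦ a ⟧ x p) (≼-⊕ (ωT^ ⟦ a ⟧) ⟦ b ⟧ x)
  succ-⊑ (cnfω _ cb _) (tail< {a} lt) = eventually-map (⊕-monoʳ-≼ (ωT^ ⟦ a ⟧)) (succ-⊑ cb lt)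
  succ-⊑ (cnfω ca cb hl) (exp< {c = c} {d} lt) =
    ⊑-trans (term-⊑ ca cb hl)
      (⊑-trans (ωT^-mono-⊑ (succ-⊑ ca lt)) (0 , λ x _ → ≼-⊕ (ωT^ ⟦ c ⟧) ⟦ d ⟧ x))

  term-⊑ : ∀ {a b} → IsCNF a → IsCNF b → HeadLE b a → sT ⟦ ω^ a + b ⟧ ⊑ ωT^ (sT ⟦ a ⟧)
  term-⊑ {a} ca cb hl with below-multiple cb hl
  ... | K , d = ⊑-trans (absorb-term ⟦ a ⟧ K d) (multiple-⊑-ωT^suc ⟦ a ⟧ (suc K))

  below-multiple : ∀ {a b} → IsCNF b → HeadLE b a → Σ[ K ∈ ℕ ] (sT ⟦ b ⟧ ⊑ ωT^ ⟦ a ⟧ ⊗ℕ K)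
  below-multiple {a} cnf0 h0 = 1 , 1 , one-≼-ωT^ ⟦ a ⟧
  below-multiple {a} (cnfω _ cb hl) (hω (inj₂ refl)) with below-multiple cb hl
  ... | K , d = suc K , absorb-term ⟦ a ⟧ K d
  below-multiple (cnfω ca cb hl) (hω (inj₁ lt)) =
    1 , ⊑-trans (term-⊑ ca cb hl) (ωT^-mono-⊑ (succ-⊑ ca lt))

F-eventually-≤ : ∀ {β γ} → IsCNF β → β ≤ₒ γ → Eventually (λ y → F β y ≤ F γ y)
F-eventually-≤ _ (inj₂ refl) = 0 , λ _ _ → ≤-refl
F-eventually-≤ {β} {γ} c (inj₁ lt) with succ-⊑ c lt
... | N , d = N , λ y p →
  FT-descent (WF-⟦⟧ γ) (≼-trans (sstep (here (≈-refl ⟦ β ⟧))) (d N ≤-refl)) p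

F-≤-iterate : ∀ {β α} → IsCNF β → β ≤ₒ α → Σ[ m ∈ ℕ ] (∀ z → F β z ≤ iter m (F α) z)
F-≤-iterate {β} {α} c le with F-eventually-≤ c le
... | N , h = suc N , λ z → begin
  F β z                 ≤⟨ F-mono β (m≤n+m z N) ⟩
  F β (N + z)           ≤⟨ h (N + z) (m≤m+n N z) ⟩
  F α (N + z)           ≤⟨ F-mono α (iter-expansive (FT-expansive ⟦ α ⟧) N z) ⟩
  F α (iter N (F α) z)  ∎

<ₒ-trans : ∀ {a b c} → a <ₒ b → b <ₒ c → a <ₒ c
<ₒ-trans 0<ω (exp< q) = 0<ω
<ₒ-trans 0<ω (tail< q) = 0<ω
<ₒ-trans (exp< p) (exp< q) = exp< (<ₒ-trans p q)
<ₒ-trans (exp< p) (tail< q) = exp< p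
<ₒ-trans (tail< p) (exp< q) = exp< q
<ₒ-trans (tail< p) (tail< q) = tail< (<ₒ-trans p q)

≤ₒ-trans : ∀ {a b c} → a ≤ₒ b → b ≤ₒ c → a ≤ₒ c
≤ₒ-trans (inj₁ p) (inj₁ q) = inj₁ (<ₒ-trans p q)
≤ₒ-trans (inj₁ p) (inj₂ refl) = inj₁ p
≤ₒ-trans (inj₂ refl) q = q

𝟎-≤ₒ : ∀ a → 𝟎 ≤ₒ a
𝟎-≤ₒ 𝟎 = inj₂ refl
𝟎-≤ₒ (ω^ a + b) = inj₁ 0<ω

<ₒ-sucₒ : ∀ a → a <ₒ sucₒ a
<ₒ-sucₒ 𝟎 = 0<ω
<ₒ-sucₒ (ω^ a + b) = tail< (<ₒ-sucₒ b)

≤ₒ-+ₒ : ∀ γ j → γ ≤ₒ γ +ₒ j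
≤ₒ-+ₒ γ zero = inj₂ refl
≤ₒ-+ₒ γ (suc j) = ≤ₒ-trans (≤ₒ-+ₒ γ j) (inj₁ (<ₒ-sucₒ _))

CNF-sucₒ : ∀ {a} → IsCNF a → IsCNF (sucₒ a)
CNF-sucₒ cnf0 = cnfω cnf0 cnf0 h0
CNF-sucₒ (cnfω ca cb hl) = cnfω ca (CNF-sucₒ cb) (HeadLE-sucₒ hl)
  where
  HeadLE-sucₒ : ∀ {b a} → HeadLE b a → HeadLE (sucₒ b) a
  HeadLE-sucₒ {a = a} h0 = hω (𝟎-≤ₒ a)
  HeadLE-sucₒ (hω le) = hω le

CNF-+ₒ : ∀ {γ} → IsCNF γ → ∀ j → IsCNF (γ +ₒ j)
CNF-+ₒ c zero = c
CNF-+ₒ c (suc j) = CNF-sucₒ (CNF-+ₒ c j)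

F-sucₒ : ∀ α w → F (sucₒ α) w ≡ iter (suc w) (F α) w
F-sucₒ α w = cong (λ t → FT t w) (⟦sucₒ⟧ α)
  where
  ⟦sucₒ⟧ : ∀ a → ⟦ sucₒ a ⟧ ≡ sT ⟦ a ⟧
  ⟦sucₒ⟧ 𝟎 = refl
  ⟦sucₒ⟧ (ω^ a + b) = cong (ωT^ ⟦ a ⟧ ⊕_) (⟦sucₒ⟧ b)

-- Majorization: every member of 𝔉_α is bounded by an iterate of F_α

maxV : ∀ {n} → Vec ℕ n → ℕ
maxV [] = 0
maxV (x ∷ v) = x ⊔ maxV v

lookup-≤-maxV : ∀ {n} (v : Vec ℕ n) i → lookup v i ≤ maxV v
lookup-≤-maxV (x ∷ v) zero = m≤m⊔n x _
lookup-≤-maxV (x ∷ v) (suc i) = ≤-trans (lookup-≤-maxV v i) (m≤n⊔m x _)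

maxV-tabulate-≤ : ∀ {n} (u : Fin n → ℕ) {B} → (∀ i → u i ≤ B) → maxV (tabulate u) ≤ B
maxV-tabulate-≤ {zero} u bound = z≤n
maxV-tabulate-≤ {suc n} u bound =
  ⊔-lub (bound zero) (maxV-tabulate-≤ (λ i → u (suc i)) (λ i → bound (suc i)))

uniform-bound : ∀ {k} (P : ℕ → Fin k → Set) → (∀ {m m'} i → m ≤ m' → P m i → P m' i) →
                (∀ i → Σ[ m ∈ ℕ ] P m i) → Σ[ m ∈ ℕ ] (∀ i → P m i)
uniform-bound {zero} P mono h = 0 , λ ()
uniform-bound {suc k} P mono h
  with h zero | uniform-bound (λ m i → P m (suc i)) (λ i → mono (suc i)) (λ i → h (suc i))
... | m₀ , p₀ | m₁ , p₁ = m₀ ⊔ m₁ , λ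
  { zero → mono zero (m≤m⊔n m₀ m₁) p₀
  ; (suc i) → mono (suc i) (m≤n⊔m m₀ m₁) (p₁ i) }

IterBound : Ord → ∀ {n} → (Vec ℕ n → ℕ) → ℕ → Set
IterBound α h m = ∀ v → h v ≤ iter m (F α) (maxV v)

IterBound-mono : ∀ {α n} {h : Vec ℕ n → ℕ} {m m'} → m ≤ m' → IterBound α h m → IterBound α h m'
IterBound-mono {α} p b v = ≤-trans (b v) (iter-mono-count (FT-inflationary ⟦ α ⟧) _ p)

-- addition is majorized by F_1(z) = 2z + 1
add-≤-F1 : ∀ a b → a + b ≤ F 1ₒ (maxV (a ∷ b ∷ []))
add-≤-F1 a b = begin
  a + b          ≤⟨ +-mono-≤ (lookup-≤-maxV (a ∷ b ∷ []) zero) (lookup-≤-maxV (a ∷ b ∷ []) (suc zero)) ⟩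
  z + z          ≤⟨ n≤1+n (z + z) ⟩
  suc z + z      ≡⟨ sym (iter-suc (suc z) z) ⟩
  F 1ₒ z         ∎
  where z = maxV (a ∷ b ∷ [])

-- majorization lemma, by induction on the derivation of h ∈ 𝔉_α; a limited
-- recursion is bounded by its limiting function
majorize : ∀ {α} → 1ₒ ≤ₒ α → ∀ {n h} → 𝔉 α n h → Σ[ m ∈ ℕ ] IterBound α h m
majorize one zeroᶠ = 0 , λ v → z≤n
majorize one addᶠ with F-≤-iterate {β = 1ₒ} (cnfω cnf0 cnf0 h0) one
... | m , bound = m , λ { (a ∷ b ∷ []) → ≤-trans (add-≤-F1 a b) (bound _) }
majorize one (projᶠ i) = 0 , λ v → lookup-≤-maxV v i
majorize {α} one (Fᶠ β cβ le) with F-≤-iterate cβ le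
... | m , bound = m , λ { (z ∷ []) → ≤-trans (bound z) (iter-mono (F-mono α) m (m≤m⊔n z 0)) }
majorize {α} one (substᶠ {h = h} {gs} hp gps)
  with majorize one hp
     | uniform-bound (λ m i → IterBound α (gs i) m) (λ i → IterBound-mono {α} {h = gs i})
                     (λ i → majorize one (gps i))
... | mₕ , bₕ | m₉ , b₉ = mₕ + m₉ , λ v → begin
  h (tabulate (λ i → gs i v))                     ≤⟨ bₕ _ ⟩
  iter mₕ (F α) (maxV (tabulate (λ i → gs i v)))  ≤⟨ iter-mono (F-mono α) mₕ
                                                       (maxV-tabulate-≤ _ (λ i → b₉ i v)) ⟩
  iter mₕ (F α) (iter m₉ (F α) (maxV v))          ≡⟨ sym (iter-+ (F α) mₕ m₉ (maxV v)) ⟩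
  iter (mₕ + m₉) (F α) (maxV v)                   ∎
majorize one (lrecᶠ _ _ _ bp _ _ le) with majorize one bp
... | m , bound = m , λ v → ≤-trans (le v) (bound v)
majorize one (extᶠ hp eq) with majorize one hp
... | m , bound = m , λ v → subst (_≤ _) (eq v) (bound v)

Unary : Ord → (ℕ → ℕ) → Set
Unary α u = 𝔉 α 1 (λ v → u (head v))

𝔉-mono : ∀ {α α'} → α ≤ₒ α' → ∀ {n h} → 𝔉 α n h → 𝔉 α' n h
𝔉-mono p zeroᶠ = zeroᶠ
𝔉-mono p addᶠ = addᶠ
𝔉-mono p (projᶠ i) = projᶠ i
𝔉-mono p (Fᶠ β c le) = Fᶠ β c (≤ₒ-trans le p)
𝔉-mono p (substᶠ hp gps) = substᶠ (𝔉-mono p hp) (λ i → 𝔉-mono p (gps i))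
𝔉-mono p (lrecᶠ r gp hp bp e0 es le) = lrecᶠ r (𝔉-mono p gp) (𝔉-mono p hp) (𝔉-mono p bp) e0 es le
𝔉-mono p (extᶠ hp eq) = extᶠ (𝔉-mono p hp) eq

compose₁ : ∀ {α n u g} → Unary α u → 𝔉 α n g → 𝔉 α n (λ v → u (g v))
compose₁ {g = g} up gp = substᶠ {gs = λ _ → g} up (λ _ → gp)

compose₂ : ∀ {α n h A B} → 𝔉 α 2 h → 𝔉 α n A → 𝔉 α n B → 𝔉 α n (λ v → h (A v ∷ B v ∷ []))
compose₂ {A = A} {B} hp p q = substᶠ {gs = pair} hp (λ { zero → p ; (suc zero) → q })
  where
  pair : Fin 2 → _
  pair zero = A
  pair (suc _) = B

add : ∀ {α n A B} → 𝔉 α n A → 𝔉 α n B → 𝔉 α n (λ v → A v + B v)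
add = compose₂ addᶠ

scale : ∀ {α n g} c → 𝔉 α n g → 𝔉 α n (λ v → c * g v)
scale zero p = zeroᶠ
scale (suc c) p = add p (scale c p)

predᶠ : ∀ {α} → Unary α (λ z → z ∸ 1)
predᶠ = lrecᶠ (λ v → head v ∸ 1) zeroᶠ (projᶠ zero) (projᶠ zero)
          (λ v → refl) (λ y v → refl) (λ { (z ∷ []) → m∸n≤m z 1 })

sucᶠ : ∀ {α} → Unary α suc
sucᶠ {α} = Fᶠ 𝟎 cnf0 (𝟎-≤ₒ α)

-- Iteration raises the level by one

iterate-bound : ∀ δ {g m} → (∀ z → g z ≤ iter m (F δ) z) → ∀ y x → iter y g x ≤ F (sucₒ δ) (m * y + x)
iterate-bound δ {g} {m} bound y x = begin
  iter y g x               ≤⟨ iter-dominated bound (iter-mono (F-mono δ) m) y x ⟩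
  iter y (iter m (F δ)) x  ≡⟨ iter-* (F δ) y m x ⟩
  iter (y * m) (F δ) x     ≤⟨ iter-mono-count (FT-inflationary ⟦ δ ⟧) x y*m≤ ⟩
  iter (suc w) (F δ) x     ≤⟨ iter-mono (F-mono δ) (suc w) (m≤n+m x (m * y)) ⟩
  iter (suc w) (F δ) w     ≡⟨ sym (F-sucₒ δ w) ⟩
  F (sucₒ δ) w             ∎
  where
  w = m * y + x
  y*m≤ : y * m ≤ suc w
  y*m≤ = ≤-trans (≤-reflexive (*-comm y m)) (≤-trans (m≤m+n (m * y) x) (n≤1+n w))

iterate-closed : ∀ {δ g} → IsCNF δ → 1ₒ ≤ₒ δ → Unary δ g →
                 𝔉 (sucₒ δ) 2 (λ v → iter (lookup v zero) g (lookup v (suc zero)))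
iterate-closed {δ} {g} cδ one gp with majorize one gp
... | m , bound =
  lrecᶠ _ (projᶠ zero) (compose₁ {u = g} (𝔉-mono lift gp) (projᶠ (suc zero))) limit
    (λ v → refl) (λ y v → refl) (λ { (y ∷ x ∷ []) → iterate-bound δ {m = m} unary-bound y x })
  where
  lift : δ ≤ₒ sucₒ δ
  lift = inj₁ (<ₒ-sucₒ δ)
  unary-bound : ∀ z → g z ≤ iter m (F δ) z
  unary-bound z = subst (λ w → g z ≤ iter m (F δ) w) (⊔-identityʳ z) (bound (z ∷ []))
  limit : 𝔉 (sucₒ δ) 2 (λ v → F (sucₒ δ) (m * lookup v zero + lookup v (suc zero)))
  limit = compose₁ {u = F (sucₒ δ)} (Fᶠ (sucₒ δ) (CNF-sucₒ cδ) (inj₂ refl))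
                   (add (scale m (projᶠ zero)) (projᶠ (suc zero)))

G-in-𝔉 : ∀ {γ f} → IsCNF γ → 1ₒ ≤ₒ γ → Unary γ f → ∀ j → Unary (γ +ₒ j) (G f (suc j))
G-in-𝔉 cγ one fp zero = extᶠ (add fp (projᶠ zero)) (λ { (z ∷ []) → refl })
G-in-𝔉 {γ} {f} cγ one fp (suc j) =
  extᶠ (compose₂ iteration (𝔉-mono (≤ₒ-+ₒ γ (suc j)) N-in-𝔉) (compose₁ {u = suc} sucᶠ (projᶠ zero)))
       (λ { (z ∷ []) → refl })
  where
  -- G_{j+2}(x) = G_{j+1}^{N_{j+2}(x)}(x+1): substitute N_{j+2} and x+1 into (★)
  iteration : 𝔉 (γ +ₒ suc j) 2 (λ v → iter (lookup v zero) (G f (suc j)) (lookup v (suc zero)))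
  iteration = iterate-closed (CNF-+ₒ cγ j) (≤ₒ-trans one (≤ₒ-+ₒ γ j)) (G-in-𝔉 cγ one fp j)
  N-in-𝔉 : Unary γ (N f (suc (suc j)))
  N-in-𝔉 = scale (suc (suc j)) (compose₁ {u = λ z → z ∸ 1} predᶠ fp)

lemma8 : (γ : Ord) → IsCNF γ → 1ₒ ≤ₒ γ →
    (f : ℕ → ℕ) → (∀ {x y} → x ≤ y → f x ≤ f y) →
    𝔉 γ 1 (λ v → f (head v)) →
    (∀ x → (1 ≤ f x) × (x ≤ f x)) →
    ∀ k → 1 ≤ k → 𝔉 (γ +ₒ (k ∸ 1)) 1 (λ v → G f k (head v))
lemma8 γ cγ one _ _ fp _ zero ()
lemma8 γ cγ one _ _ fp _ (suc j) _ = G-in-𝔉 cγ one fp j
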